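{- Let $f:\mathbb{N}\to\mathbb{N}$ be increasing with $f(0)>0$, let $k>0$, $t\in\mathbb{N}$, and $x\in\mathbb{N}^k$ with $\|x\|_\infty\le f(t)-1$. Then $\mathbb{N}^k/x\hookrightarrow k\times(f(t)-1)\times\mathbb{N}^{k-1}$, i.e. $\mathbb{N}^k/x$ is strongly reflected by $N_k(t)\times\mathbb{N}^{k-1}$.
   Context: $\mathbb{N}^k$ carries the coordinatewise product ordering. For a quasi-ordered set $A$ and $a\in A$, $A/a=\{x\in A\mid a\not\le x\}$. $N_k(t)=k\cdot(f(t)-1)$, and $p\times\mathbb{N}^{m}$ is the disjoint union of $p$ copies of $\mathbb{N}^m$, ordered so that elements of different copies are incomparable and elements of the same copy compare coordinatewise. $\|x\|_\infty$ is the maximum coordinate (0 for the empty tuple). For quasi-orderings $A_1,A_2$ that are subsets of such disjoint unions of powers of $\mathbb{N}$, a map $h:A_1\to A_2$ is a reflection if $h(a)\le h(b)$ implies $a\le b$ for all $a,b\in A_1$, and a strong reflection (written $A_1\hookrightarrow A_2$) if moreover $\|h(x)\|_\infty\le\|x\|_\infty$ for all $x$. -}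

module Defs where

open import Data.Nat using (ℕ; _≤_; _∸_; _*_; _⊔_)
open import Data.Fin using (Fin)
open import Data.Vec using (Vec; foldr)
open import Data.Vec.Relation.Binary.Pointwise.Inductive using (Pointwise)
open import Data.Product using (Σ; _×_; proj₁; proj₂)
open import Relation.Nullary using (¬_)
open import Relation.Binary.PropositionalEquality using (_≡_)

_≤ᵥ_ : {k : ℕ} → Vec ℕ k → Vec ℕ k → Set
_≤ᵥ_ = Pointwise _≤_

‖_‖∞ : {k : ℕ} → Vec ℕ k → ℕ
‖ v ‖∞ = foldr (λ _ → ℕ) _⊔_ 0 v

-- ℕ^k / x  =  { y ∈ ℕ^k | x ≰ y }, ordered as a subset of ℕ^k
NkDiv : (k : ℕ) → Vec ℕ k → Set
NkDiv k x = Σ (Vec ℕ k) (λ y → ¬ (x ≤ᵥ y))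

-- p × ℕ^m : disjoint union of p copies of ℕ^m
DU : ℕ → ℕ → Set
DU p m = Fin p × Vec ℕ m

_≤DU_ : {p m : ℕ} → DU p m → DU p m → Set
a ≤DU b = (proj₁ a ≡ proj₁ b) × (proj₂ a ≤ᵥ proj₂ b)

‖_‖DU : {p m : ℕ} → DU p m → ℕ
‖ a ‖DU = ‖ proj₂ a ‖∞

Nk : (f : ℕ → ℕ) → ℕ → ℕ → ℕ
Nk f k t = k * (f t ∸ 1)

StronglyReflects : (k : ℕ) → Vec ℕ k → (p m : ℕ) → Set
StronglyReflects k x p m =
  Σ (NkDiv k x → DU p m) λ h →
    ((a b : NkDiv k x) → h a ≤DU h b → proj₁ a ≤ᵥ proj₁ b)
    × ((a : NkDiv k x) → ‖ h a ‖DU ≤ ‖ proj₁ a ‖∞)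

module Submission where

-- If y ∈ ℕ^k / x, i.e. x ≰ y, then some coordinate i witnesses this:
-- y_i < x_i ≤ ‖x‖∞ ≤ c.  Send y to the copy indexed by the pair (i, y_i) in
-- the k·c copies of ℕ^(k-1), taking as ℕ^(k-1) component y with coordinate
-- i deleted.  Two images in the same copy share both the witness index i and
-- the value y_i, so comparing the remaining coordinates recovers y ≤ z; and
-- deleting a coordinate never increases the maximum norm.

open import Defs
open import Data.Nat using (ℕ; _≤_; _<_; _∸_; _*_; suc; _≤?_)
open import Data.Nat.Properties
  using (≰⇒>; ≤-trans; ≤-reflexive; <-≤-trans; m≤m⊔n; m≤n⊔m; ⊔-monoʳ-≤)
open import Data.Vec using (Vec; _∷_; []; lookup; removeAt)
open import Data.Vec.Relation.Binary.Pointwise.Inductive using (_∷_; [])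
open import Data.Fin using (Fin; zero; suc; combine; fromℕ<; toℕ)
open import Data.Fin.Properties using (combine-injective; toℕ-fromℕ<)
open import Data.Product using (Σ; _,_; proj₁; proj₂)
open import Relation.Nullary using (¬_; yes; no)
open import Relation.Binary.PropositionalEquality
  using (_≡_; refl; sym; cong; subst; module ≡-Reasoning)

-- A failure of x ≤ᵥ y is witnessed by a coordinate where y is strictly below x
-- (constructive, since ≤ on ℕ is decidable).
witness : ∀ {k} (x y : Vec ℕ k) → ¬ (x ≤ᵥ y) → Σ (Fin k) λ i → lookup y i < lookup x i
witness []      []      x≰y with x≰y []
... | ()
witness (a ∷ x) (b ∷ y) x≰y with a ≤? b
... | no  a≰b = zero , ≰⇒> a≰b
... | yes a≤b with witness x y (λ x≤y → x≰y (a≤b ∷ x≤y))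
...   | i , yᵢ<xᵢ = suc i , yᵢ<xᵢ

lookup≤‖‖∞ : ∀ {k} (x : Vec ℕ k) i → lookup x i ≤ ‖ x ‖∞
lookup≤‖‖∞ (a ∷ x) zero    = m≤m⊔n a _
lookup≤‖‖∞ (a ∷ x) (suc i) = ≤-trans (lookup≤‖‖∞ x i) (m≤n⊔m a _)

removeAt≤‖‖∞ : ∀ {n} (y : Vec ℕ (suc n)) i → ‖ removeAt y i ‖∞ ≤ ‖ y ‖∞
removeAt≤‖‖∞ (a ∷ y)           zero    = m≤n⊔m a _
removeAt≤‖‖∞ (a ∷ y@(_ ∷ _)) (suc i) = ⊔-monoʳ-≤ a (removeAt≤‖‖∞ y i)

≤ᵥ-from-removeAt : ∀ {n} (y z : Vec ℕ (suc n)) i →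
  lookup y i ≤ lookup z i → removeAt y i ≤ᵥ removeAt z i → y ≤ᵥ z
≤ᵥ-from-removeAt (a ∷ y) (b ∷ z) zero a≤b y≤z = a≤b ∷ y≤z
≤ᵥ-from-removeAt (a ∷ y@(_ ∷ _)) (b ∷ z@(_ ∷ _)) (suc i) yᵢ≤zᵢ (a≤b ∷ rest) =
  a≤b ∷ ≤ᵥ-from-removeAt y z i yᵢ≤zᵢ rest

module Reflection (n c : ℕ) (x : Vec ℕ (suc n)) (‖x‖≤c : ‖ x ‖∞ ≤ c) where

  index : NkDiv (suc n) x → Fin (suc n)
  index (y , x≰y) = proj₁ (witness x y x≰y)

  value<c : (a : NkDiv (suc n) x) → lookup (proj₁ a) (index a) < c
  value<c (y , x≰y) with witness x y x≰y
  ... | i , yᵢ<xᵢ = <-≤-trans yᵢ<xᵢ (≤-trans (lookup≤‖‖∞ x i) ‖x‖≤c)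

  value : NkDiv (suc n) x → Fin c
  value a = fromℕ< (value<c a)

  embed : NkDiv (suc n) x → DU (suc n * c) n
  embed a = combine (index a) (value a) , removeAt (proj₁ a) (index a)

  -- equal copies force equal index and equal value, hence y ≤ z
  reflects : (a b : NkDiv (suc n) x) → embed a ≤DU embed b → proj₁ a ≤ᵥ proj₁ b
  reflects a@(y , _) b@(z , _) (same-copy , rest≤)
    with combine-injective (index a) (value a) (index b) (value b) same-copy
  ... | same-index , same-value =
    ≤ᵥ-from-removeAt y z (index a) (≤-reflexive coordinate) rest≤′
    where
    open ≡-Reasoning
    coordinate : lookup y (index a) ≡ lookup z (index a)
    coordinate = begin
      lookup y (index a)   ≡⟨ sym (toℕ-fromℕ< (value<c a)) ⟩
      toℕ (value a)        ≡⟨ cong toℕ same-value ⟩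
      toℕ (value b)        ≡⟨ toℕ-fromℕ< (value<c b) ⟩
      lookup z (index b)   ≡⟨ cong (lookup z) (sym same-index) ⟩
      lookup z (index a)   ∎
    rest≤′ : removeAt y (index a) ≤ᵥ removeAt z (index a)
    rest≤′ = subst (λ j → removeAt y (index a) ≤ᵥ removeAt z j) (sym same-index) rest≤

  norm-bound : (a : NkDiv (suc n) x) → ‖ embed a ‖DU ≤ ‖ proj₁ a ‖∞
  norm-bound a = removeAt≤‖‖∞ (proj₁ a) (index a)

  stronglyReflects : StronglyReflects (suc n) x (suc n * c) n
  stronglyReflects = embed , reflects , norm-bound

-- Instance c = f(t) − 1; k > 0 lets us write k = n + 1, so N_k(t) = (n+1)·c.
lemma2 : (f : ℕ → ℕ) → (∀ m n → m ≤ n → f m ≤ f n) → 0 < f 0 →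
    (k : ℕ) → 0 < k → (t : ℕ) → (x : Vec ℕ k) → ‖ x ‖∞ ≤ f t ∸ 1 →
    StronglyReflects k x (Nk f k t) (k ∸ 1)
lemma2 f _ _ (suc n) _ t x ‖x‖≤fₜ-1 =
  Reflection.stronglyReflects n (f t ∸ 1) x ‖x‖≤fₜ-1
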